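{- Let $G=(A,B,\mathcal{E})$ be a bipartite graph containing no induced $n\Lambda_k$, such that every vertex of $B$ has degree at most $d$. Then at most $nkd^2$ vertices of $A$ have degree at least $k$.
   Context: $\Lambda_k$ is the star with centre in the top part $A$ and $k$ leaves in the bottom part $B$; $n\Lambda_k$ is the disjoint union of $n$ copies; induced containment respects sides. -}

module Defs where

open import Data.Nat using (ℕ; zero; suc; _+_; _≤ᵇ_)
open import Data.Bool using (Bool; true; false; if_then_else_)
open import Data.Fin using (Fin; zero; suc)
open import Data.Product using (_×_; _,_; Σ-syntax)
open import Relation.Binary.PropositionalEquality using (_≡_)
open import Function.Definitions using (Injective)
open import Relation.Nullary using (¬_)

-- A finite bipartite graph with top part A = Fin a, bottom part B = Fin b,
-- given by its (decidable) bipartite adjacency relation.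
record BipGraph (a b : ℕ) : Set where
  field
    adj : Fin a → Fin b → Bool

open BipGraph public

count : (m : ℕ) → (Fin m → Bool) → ℕ
count zero    P = 0
count (suc m) P = (if P zero then 1 else 0) + count m (λ i → P (suc i))

degA : ∀ {a b} → BipGraph a b → Fin a → ℕ
degA {b = b} G x = count b (λ y → adj G x y)

degB : ∀ {a b} → BipGraph a b → Fin b → ℕ
degB {a = a} G y = count a (λ x → adj G x y)

-- An induced copy of nΛ_k in G, respecting sides: n distinct centres in A,
-- n·k distinct leaves in B (leaf l of star i), such that centre i is adjacent
-- to leaf (j , l) exactly when i = j. (There are no edges inside A or inside B
-- in a bipartite graph, so this is exactly induced containment.)
record InducedStars {a b : ℕ} (G : BipGraph a b) (n k : ℕ) : Set where
  field
    centre     : Fin n → Fin a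
    leaf       : Fin n × Fin k → Fin b
    centre-inj : Injective _≡_ _≡_ centre
    leaf-inj   : Injective _≡_ _≡_ leaf
    edge⇒same  : ∀ i j l → adj G (centre i) (leaf (j , l)) ≡ true → i ≡ j
    same⇒edge  : ∀ i l → adj G (centre i) (leaf (i , l)) ≡ true

NoInducedStars : ∀ {a b} → BipGraph a b → ℕ → ℕ → Set
NoInducedStars G n k = ¬ InducedStars G n k

module Submission where

-- Let G = (A, B, E) be bipartite with all degrees in B at most d, and call a
-- top vertex heavy if its degree is at least k.  Give every heavy vertex w a
-- set L(w) of k of its neighbours, and say that w sees z ≠ w when z is
-- adjacent to a vertex of L(w).  Each vertex of L(w) has at most d - 1
-- neighbours besides w, so w sees at most c = k(d - 1) vertices.  Heavy
-- centres that pairwise do not see each other, together with their leaf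
-- sets, form an induced copy of nΛ_k.  In any digraph of out-degree at most c
-- a greedy argument finds n pairwise non-adjacent vertices among more than
-- n(1 + 2c) candidates: double counting yields a candidate with in-degree at
-- most c, and choosing it discards at most 1 + 2c candidates.  Since
-- 1 + 2k(d - 1) ≤ k d², more than n k d² heavy vertices would give an induced
-- nΛ_k.

open import Defs
open import Data.Nat using (ℕ; _≤_; _*_; _^_; _≤ᵇ_)
open import Data.Fin using (Fin)

open import Data.Nat using (zero; suc; _+_; _∸_; _<_; z≤n; s≤s; _≤?_)
open import Data.Nat.Properties hiding (_≟_; suc-injective)
open import Data.Nat.Tactic.RingSolver using (solve-∀)
open import Data.Fin using (zero; suc)
open import Data.Fin.Properties using (_≟_; any?; suc-injective)
open import Data.Bool using (Bool; true; false; _∧_; _∨_; not; if_then_else_)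
open import Data.Bool.Properties using (T-≡) renaming (_≟_ to _≟ᵇ_)
open import Data.Product using (Σ-syntax; ∃; _×_; _,_; proj₁; proj₂)
open import Data.Empty using (⊥-elim)
open import Data.Vec.Functional using (foldr)
open import Function.Base using (_∘_)
open import Function.Bundles using (Equivalence)
open import Function.Definitions using (Injective)
open import Relation.Binary.PropositionalEquality
open import Relation.Nullary using (does; yes; no; contradiction)
open import Relation.Nullary.Decidable using (dec-true; dec-false; _×-dec_)
open import Algebra.Properties.CommutativeMonoid.Sum +-0-commutativeMonoid
  using (sum-syntax; sum-cong-≗; ∑-distrib-+; ∑-comm)

true≢false : true ≢ false
true≢false ()

∧-true-right : ∀ p {q} → p ∧ q ≡ true → q ≡ true
∧-true-right true  q≡true = q≡true
∧-true-right false ()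

≤ᵇ-true⇒≤ : ∀ m n → (m ≤ᵇ n) ≡ true → m ≤ n
≤ᵇ-true⇒≤ m n m≤ᵇn = ≤ᵇ⇒≤ m n (Equivalence.from T-≡ m≤ᵇn)

ind : Bool → ℕ
ind b = if b then 1 else 0

count-as-sum : ∀ m (P : Fin m → Bool) → count m P ≡ ∑[ i < m ] ind (P i)
count-as-sum zero    P = refl
count-as-sum (suc m) P = cong (ind (P zero) +_) (count-as-sum m (λ i → P (suc i)))

sum-mono : ∀ m {f g : Fin m → ℕ} → (∀ i → f i ≤ g i) → ∑[ i < m ] f i ≤ ∑[ i < m ] g i
sum-mono zero    f≤g = z≤n
sum-mono (suc m) f≤g = +-mono-≤ (f≤g zero) (sum-mono m (λ i → f≤g (suc i)))

count-none : ∀ m → count m (λ _ → false) ≡ 0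
count-none zero    = refl
count-none (suc m) = count-none m

count-mono : ∀ m {P Q : Fin m → Bool} → (∀ i → P i ≡ true → Q i ≡ true)
           → count m P ≤ count m Q
count-mono m {P} {Q} P⇒Q = begin
    count m P             ≡⟨ count-as-sum m P ⟩
    ∑[ i < m ] ind (P i)  ≤⟨ sum-mono m (λ i → ind-mono (P⇒Q i)) ⟩
    ∑[ i < m ] ind (Q i)  ≡⟨ count-as-sum m Q ⟨
    count m Q             ∎
  where
  open ≤-Reasoning
  ind-mono : ∀ {p q} → (p ≡ true → q ≡ true) → ind p ≤ ind q
  ind-mono {false}         p⇒q = z≤n
  ind-mono {true}  {true}  p⇒q = ≤-refl
  ind-mono {true}  {false} p⇒q with () ← p⇒q refl

count-∨ : ∀ m (P Q : Fin m → Bool) → count m (λ i → P i ∨ Q i) ≤ count m P + count m Q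
count-∨ m P Q = begin
    count m (λ i → P i ∨ Q i)                      ≡⟨ count-as-sum m _ ⟩
    ∑[ i < m ] ind (P i ∨ Q i)                     ≤⟨ sum-mono m (λ i → ind-∨ (P i) (Q i)) ⟩
    ∑[ i < m ] (ind (P i) + ind (Q i))             ≡⟨ ∑-distrib-+ (λ i → ind (P i)) (λ i → ind (Q i)) ⟩
    ∑[ i < m ] ind (P i) + ∑[ i < m ] ind (Q i)    ≡⟨ cong₂ _+_ (count-as-sum m P) (count-as-sum m Q) ⟨
    count m P + count m Q                          ∎
  where
  open ≤-Reasoning
  ind-∨ : ∀ p q → ind (p ∨ q) ≤ ind p + ind q
  ind-∨ true  q = s≤s z≤n
  ind-∨ false q = ≤-refl

count-split : ∀ m (P Q : Fin m → Bool)
            → count m P ≡ count m (λ i → P i ∧ Q i) + count m (λ i → P i ∧ not (Q i))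
count-split m P Q = begin
    count m P                                        ≡⟨ count-as-sum m P ⟩
    ∑[ i < m ] ind (P i)                             ≡⟨ sum-cong-≗ (λ i → ind-split (P i) (Q i)) ⟩
    ∑[ i < m ] (ind (P∧Q i) + ind (P∧¬Q i))          ≡⟨ ∑-distrib-+ (λ i → ind (P∧Q i)) (λ i → ind (P∧¬Q i)) ⟩
    ∑[ i < m ] ind (P∧Q i) + ∑[ i < m ] ind (P∧¬Q i) ≡⟨ cong₂ _+_ (count-as-sum m P∧Q) (count-as-sum m P∧¬Q) ⟨
    count m P∧Q + count m P∧¬Q                       ∎
  where
  open ≡-Reasoning
  P∧Q P∧¬Q : Fin m → Bool
  P∧Q i = P i ∧ Q i
  P∧¬Q i = P i ∧ not (Q i)
  ind-split : ∀ p q → ind p ≡ ind (p ∧ q) + ind (p ∧ not q)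
  ind-split false q     = refl
  ind-split true  true  = refl
  ind-split true  false = refl

count-remove : ∀ m (P : Fin m → Bool) (x : Fin m) → P x ≡ true
             → count m P ≡ suc (count m (λ z → not (does (z ≟ x)) ∧ P z))
count-remove (suc m) P zero    Px rewrite Px = refl
count-remove (suc m) P (suc x) Px = begin
    ind (P zero) + count m (λ z → P (suc z))
      ≡⟨ cong (ind (P zero) +_) (count-remove m (λ z → P (suc z)) x Px) ⟩
    ind (P zero) + suc (count m (λ z → not (does (z ≟ x)) ∧ P (suc z)))
      ≡⟨ +-suc (ind (P zero)) _ ⟩
    suc (ind (P zero) + count m (λ z → not (does (z ≟ x)) ∧ P (suc z))) ∎
  where open ≡-Reasoning

count-witness : ∀ m (P : Fin m → Bool) → 0 < count m P → ∃ λ x → P x ≡ true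
count-witness (suc m) P pos with P zero in Pzero
... | true  = zero , Pzero
... | false with count-witness m (λ z → P (suc z)) pos
...   | x , Px = suc x , Px

choose : ∀ {m} (P : Fin m → Bool) {k} → k ≤ count m P
       → Σ[ f ∈ (Fin k → Fin m) ] Injective _≡_ _≡_ f × (∀ l → P (f l) ≡ true)
choose {m}     P {zero}  _ = (λ ()) , (λ {x} → λ {}) , (λ ())
choose {suc m} P {suc k} k≤count with P zero in Pzero
... | false with choose (λ z → P (suc z)) k≤count
...   | f , f-inj , Pf = (λ l → suc (f l)) , (λ eq → f-inj (suc-injective eq)) , Pf
choose {suc m} P {suc k} (s≤s k≤count) | true with choose (λ z → P (suc z)) k≤count
...   | f , f-inj , Pf = g , g-inj , Pg
  where
  g : Fin (suc k) → Fin (suc m)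
  g zero    = zero
  g (suc l) = suc (f l)
  g-inj : Injective _≡_ _≡_ g
  g-inj {zero}  {zero}   _  = refl
  g-inj {suc l} {suc l′} eq = cong suc (f-inj (suc-injective eq))
  Pg : ∀ l → P (g l) ≡ true
  Pg zero    = Pzero
  Pg (suc l) = Pf l

sum-over : ∀ m (P : Fin m → Bool) s → ∑[ i < m ] (if P i then s else 0) ≡ count m P * s
sum-over zero    P s = refl
sum-over (suc m) P s with P zero
... | true  = cong (s +_) (sum-over m (λ i → P (suc i)) s)
... | false = sum-over m (λ i → P (suc i)) s

below-average : ∀ m (P : Fin m → Bool) (g : Fin m → ℕ) c → 0 < count m P
              → ∑[ i < m ] (if P i then g i else 0) ≤ count m P * c
              → ∃ λ x → P x ≡ true × g x ≤ c
below-average m P g c nonempty total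
  with any? (λ x → (P x ≟ᵇ true) ×-dec (g x ≤? c))
... | yes light = light
... | no  none  = contradiction total (<⇒≱ (begin-strict
    count m P * c                            <⟨ m<n+m _ nonempty ⟩
    count m P + count m P * c                ≡⟨ *-suc (count m P) c ⟨
    count m P * suc c                        ≡⟨ sum-over m P (suc c) ⟨
    ∑[ i < m ] (if P i then suc c else 0)    ≤⟨ sum-mono m exceeds ⟩
    ∑[ i < m ] (if P i then g i else 0)      ∎))
  where
  open ≤-Reasoning
  exceeds : ∀ i → (if P i then suc c else 0) ≤ (if P i then g i else 0)
  exceeds i with P i in Pi
  ... | true  = ≰⇒> (λ gi≤c → none (i , Pi , gi≤c))
  ... | false = z≤n

count-pairs : ∀ m n (Q : Fin m → Fin n → Bool)
            → ∑[ x < n ] count m (λ z → Q z x) ≡ ∑[ z < m ] count n (Q z)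
count-pairs m n Q = begin
    ∑[ x < n ] count m (λ z → Q z x)          ≡⟨ sum-cong-≗ (λ x → count-as-sum m (λ z → Q z x)) ⟩
    ∑[ x < n ] ∑[ z < m ] ind (Q z x)         ≡⟨ ∑-comm (λ x z → ind (Q z x)) ⟩
    ∑[ z < m ] ∑[ x < n ] ind (Q z x)         ≡⟨ sum-cong-≗ (λ z → count-as-sum n (Q z)) ⟨
    ∑[ z < m ] count n (Q z)                  ∎
  where open ≡-Reasoning

-- Within any vertex set P,
-- double counting gives a vertex x of P with at most c in-neighbours in P;
-- taking x and discarding its in- and out-neighbours costs at most 1 + 2c
-- vertices, so P contains n pairwise non-adjacent vertices as soon as
-- n * (1 + 2c) < |P|.
module Greedy {a : ℕ} (R : Fin a → Fin a → Bool) (c : ℕ)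
              (out-degree : ∀ x → count a (R x) ≤ c) where

  record Independent (P : Fin a → Bool) (n : ℕ) : Set where
    field
      member      : Fin n → Fin a
      member-inj  : Injective _≡_ _≡_ member
      member-in   : ∀ i → P (member i) ≡ true
      independent : ∀ i j → i ≢ j → R (member i) (member j) ≡ false

  in-degree : (Fin a → Bool) → Fin a → ℕ
  in-degree P x = count a (λ z → P z ∧ R z x)

  low-in-degree : ∀ P → 0 < count a P → ∃ λ x → P x ≡ true × in-degree P x ≤ c
  low-in-degree P nonempty = below-average a P (in-degree P) c nonempty (begin
      ∑[ x < a ] (if P x then in-degree P x else 0)  ≤⟨ sum-mono a (λ x → if-≤ (P x)) ⟩
      ∑[ x < a ] in-degree P x                       ≡⟨ count-pairs a a (λ z x → P z ∧ R z x) ⟩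
      ∑[ z < a ] count a (λ x → P z ∧ R z x)         ≤⟨ sum-mono a out-degree-in ⟩
      ∑[ z < a ] (if P z then c else 0)              ≡⟨ sum-over a P c ⟩
      count a P * c                                  ∎)
    where
    open ≤-Reasoning
    if-≤ : ∀ {n} b → (if b then n else 0) ≤ n
    if-≤ true  = ≤-refl
    if-≤ false = z≤n
    out-degree-in : ∀ z → count a (λ x → P z ∧ R z x) ≤ (if P z then c else 0)
    out-degree-in z with P z
    ... | true  = out-degree z
    ... | false = ≤-reflexive (count-none a)

  remaining : (Fin a → Bool) → Fin a → Fin a → Bool
  remaining P x z = (not (does (z ≟ x)) ∧ P z) ∧ not (R x z ∨ (P z ∧ R z x))

  remaining-size : ∀ P x → P x ≡ true
                 → count a P ≤ suc (c + in-degree P x) + count a (remaining P x)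
  remaining-size P x Px = begin
      count a P                                     ≡⟨ count-remove a P x Px ⟩
      suc (count a P-x)                             ≡⟨ cong suc (count-split a P-x near) ⟩
      suc (count a (λ z → P-x z ∧ near z) + count a (remaining P x))
        ≤⟨ s≤s (+-monoˡ-≤ _ (count-mono a (λ z → ∧-true-right (P-x z)))) ⟩
      suc (count a near + count a (remaining P x))
        ≤⟨ s≤s (+-monoˡ-≤ _ (≤-trans (count-∨ a (R x) _) (+-monoˡ-≤ _ (out-degree x)))) ⟩
      suc (c + in-degree P x) + count a (remaining P x) ∎
    where
    open ≤-Reasoning
    P-x near : Fin a → Bool
    P-x z  = not (does (z ≟ x)) ∧ P z
    near z = R x z ∨ (P z ∧ R z x)

  remaining-bits : ∀ e p r s → (not e ∧ p) ∧ not (r ∨ (p ∧ s)) ≡ true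
                 → e ≡ false × p ≡ true × r ≡ false × s ≡ false
  remaining-bits false true  false false refl = refl , refl , refl , refl
  remaining-bits true  _     _     _     ()
  remaining-bits false false _     _     ()
  remaining-bits false true  true  _     ()
  remaining-bits false true  false true  ()

  remaining-spec : ∀ P x z → remaining P x z ≡ true
                 → P z ≡ true × z ≢ x × R x z ≡ false × R z x ≡ false
  remaining-spec P x z rem
    with z≟x-false , Pz , Rxz , Rzx ← remaining-bits (does (z ≟ x)) (P z) (R x z) (R z x) rem
    = Pz , (λ z≡x → true≢false (trans (sym (dec-true (z ≟ x) z≡x)) z≟x-false)) , Rxz , Rzx

  extend : ∀ {P x n} → P x ≡ true → Independent (remaining P x) n → Independent P (suc n)
  extend {P} {x} {n} Px I = record
    { member = member′ ; member-inj = member′-inj ; member-in = member′-in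
    ; independent = independent′ }
    where
    open Independent I
    spec : ∀ i → P (member i) ≡ true × member i ≢ x
                 × R x (member i) ≡ false × R (member i) x ≡ false
    spec i = remaining-spec P x (member i) (member-in i)
    member′ : Fin (suc n) → Fin a
    member′ zero    = x
    member′ (suc i) = member i
    member′-inj : Injective _≡_ _≡_ member′
    member′-inj {zero}  {zero}  _  = refl
    member′-inj {zero}  {suc j} eq = ⊥-elim (proj₁ (proj₂ (spec j)) (sym eq))
    member′-inj {suc i} {zero}  eq = ⊥-elim (proj₁ (proj₂ (spec i)) eq)
    member′-inj {suc i} {suc j} eq = cong suc (member-inj eq)
    member′-in : ∀ i → P (member′ i) ≡ true
    member′-in zero    = Px
    member′-in (suc i) = proj₁ (spec i)
    independent′ : ∀ i j → i ≢ j → R (member′ i) (member′ j) ≡ false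
    independent′ zero    zero    i≢j = ⊥-elim (i≢j refl)
    independent′ zero    (suc j) _   = proj₁ (proj₂ (proj₂ (spec j)))
    independent′ (suc i) zero    _   = proj₂ (proj₂ (proj₂ (spec i)))
    independent′ (suc i) (suc j) i≢j = independent i j (λ i≡j → i≢j (cong suc i≡j))

  greedy : ∀ n P → n * suc (c + c) < count a P → Independent P n
  greedy zero    P _     = record
    { member = λ () ; member-inj = λ {i} → λ {} ; member-in = λ () ; independent = λ () }
  greedy (suc n) P large = extend Px (greedy n (remaining P x) still-large)
    where
    light : ∃ λ x → P x ≡ true × in-degree P x ≤ c
    light = low-in-degree P (≤-trans (s≤s z≤n) large)
    x : Fin a
    x = proj₁ light
    Px : P x ≡ true
    Px = proj₁ (proj₂ light)
    still-large : n * suc (c + c) < count a (remaining P x)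
    still-large = +-cancelˡ-< (suc (c + c)) _ _ (begin-strict
      suc (c + c) + n * suc (c + c)                  <⟨ large ⟩
      count a P                                      ≤⟨ remaining-size P x Px ⟩
      suc (c + in-degree P x) + count a (remaining P x)
        ≤⟨ +-monoˡ-≤ _ (s≤s (+-monoʳ-≤ c (proj₂ (proj₂ light)))) ⟩
      suc (c + c) + count a (remaining P x)          ∎)
      where open ≤-Reasoning

anyOf : ∀ {k} → (Fin k → Bool) → Bool
anyOf = foldr _∨_ false

anyOf-intro : ∀ {k} (f : Fin k → Bool) l → f l ≡ true → anyOf f ≡ true
anyOf-intro f zero    fl≡true rewrite fl≡true = refl
anyOf-intro f (suc l) fl≡true with f zero
... | true  = refl
... | false = anyOf-intro (λ i → f (suc i)) l fl≡true

count-anyOf : ∀ m k (Q : Fin m → Fin k → Bool) c → (∀ l → count m (λ z → Q z l) ≤ c)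
            → count m (λ z → anyOf (Q z)) ≤ k * c
count-anyOf m zero    Q c _     = ≤-reflexive (count-none m)
count-anyOf m (suc k) Q c bound = ≤-trans
  (count-∨ m (λ z → Q z zero) (λ z → anyOf (λ l → Q z (suc l))))
  (+-mono-≤ (bound zero) (count-anyOf m k (λ z l → Q z (suc l)) c (λ l → bound (suc l))))

-- A top vertex is heavy if its degree is at least k; every heavy vertex gets k
-- distinct neighbours as leaves (y₀ is only a placeholder for light vertices).
module Stars {a b : ℕ} (G : BipGraph a b) (k d : ℕ)
             (degB≤d : ∀ y → degB G y ≤ d) (y₀ : Fin b) where

  heavy : Fin a → Bool
  heavy x = k ≤ᵇ degA G x

  leaves : Fin a → Fin k → Fin b
  leaves x with k ≤? degA G x
  ... | yes k≤deg = proj₁ (choose (adj G x) k≤deg)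
  ... | no  _     = λ _ → y₀

  leaves-spec : ∀ x → heavy x ≡ true
              → Injective _≡_ _≡_ (leaves x) × (∀ l → adj G x (leaves x l) ≡ true)
  leaves-spec x hx with k ≤? degA G x
  ... | yes k≤deg = proj₂ (choose (adj G x) k≤deg)
  ... | no  k≰deg = contradiction (≤ᵇ-true⇒≤ k _ hx) k≰deg

  -- w sees z ≠ w when z is adjacent to a leaf of w that is a neighbour of w;
  -- an edge between a centre and a leaf of another centre is such a sighting
  sees : Fin a → Fin a → Bool
  sees w z = anyOf (λ l → adj G w (leaves w l) ∧ (not (does (z ≟ w)) ∧ adj G z (leaves w l)))

  -- every neighbour y of w has at most d - 1 neighbours besides w
  sees-out-degree : ∀ w → count a (sees w) ≤ k * (d ∸ 1)
  sees-out-degree w = count-anyOf a k _ (d ∸ 1) (λ l → through (leaves w l))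
    where
    through : ∀ y → count a (λ z → adj G w y ∧ (not (does (z ≟ w)) ∧ adj G z y)) ≤ d ∸ 1
    through y with adj G w y in w~y
    ... | true  = ∸-monoˡ-≤ 1 (subst (_≤ d) (count-remove a (λ z → adj G z y) w w~y) (degB≤d y))
    ... | false = ≤-trans (≤-reflexive (count-none a)) z≤n

  open Greedy sees (k * (d ∸ 1)) sees-out-degree public

  induced-stars : ∀ {n} → Independent heavy n → InducedStars G n k
  induced-stars {n} I = record
    { centre = member ; leaf = leaf ; centre-inj = member-inj ; leaf-inj = leaf-inj
    ; edge⇒same = edge⇒same ; same⇒edge = λ i → proj₂ (spec i) }
    where
    open Independent I
    spec : ∀ i → Injective _≡_ _≡_ (leaves (member i))
                 × (∀ l → adj G (member i) (leaves (member i) l) ≡ true)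
    spec i = leaves-spec (member i) (member-in i)
    leaf : Fin n × Fin k → Fin b
    leaf (j , l) = leaves (member j) l
    edge⇒same : ∀ i j l → adj G (member i) (leaf (j , l)) ≡ true → i ≡ j
    edge⇒same i j l edge with i ≟ j
    ... | yes i≡j = i≡j
    ... | no  i≢j = ⊥-elim (true≢false (trans (sym (anyOf-intro _ l sighting)) (independent j i (i≢j ∘ sym))))
      where
      sighting : adj G (member j) (leaf (j , l))
                 ∧ (not (does (member i ≟ member j)) ∧ adj G (member i) (leaf (j , l))) ≡ true
      sighting rewrite proj₂ (spec j) l | dec-false (member i ≟ member j) (i≢j ∘ member-inj) | edge = refl
    leaf-inj : Injective _≡_ _≡_ leaf
    leaf-inj {i , l} {j , l′} eq
      with edge⇒same i j l′ (subst (λ y → adj G (member i) y ≡ true) eq (proj₂ (spec i) l))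
    ... | refl = cong (i ,_) (proj₁ (spec i) eq)

-- The budget of the greedy step fits into k d²:
-- k d² - (1 + 2k(d - 1)) = k (d - 1)² + (k - 1) ≥ 0.
star-budget : ∀ k d → 1 ≤ k → 1 ≤ d → suc (k * (d ∸ 1) + k * (d ∸ 1)) ≤ k * d ^ 2
star-budget (suc j) (suc e) _ _ = ≤-trans (m≤m+n _ (j + suc j * e * e)) (≤-reflexive (expand j e))
  where
  expand : ∀ j e → suc (suc j * e + suc j * e) + (j + suc j * e * e) ≡ suc j * (suc e * (suc e * 1))
  expand = solve-∀

-- If more than n k d² top vertices had degree ≥ k, such a vertex x₀ and a
-- neighbour y₀ would exist (so d ≥ 1), and the greedy selection would find n
-- mutually unseen heavy centres, i.e. an induced nΛ_k.
lemma21 : (a b n k d : ℕ) → 1 ≤ k → (G : BipGraph a b)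
          → NoInducedStars G n k
          → (∀ (y : Fin b) → degB G y ≤ d)
          → count a (λ x → k ≤ᵇ degA G x) ≤ n * k * d ^ 2
lemma21 a b n k d 1≤k G noStars degB≤d with count a (λ x → k ≤ᵇ degA G x) ≤? n * k * d ^ 2
... | yes few  = few
... | no  many = contradiction (S.induced-stars (S.greedy n S.heavy enough)) noStars
  where
  more : n * k * d ^ 2 < count a (λ x → k ≤ᵇ degA G x)
  more = ≰⇒> many
  x₀ : ∃ λ x → (k ≤ᵇ degA G x) ≡ true
  x₀ = count-witness a _ (≤-trans (s≤s z≤n) more)
  y₀ : ∃ λ y → adj G (proj₁ x₀) y ≡ true
  y₀ = count-witness b (adj G (proj₁ x₀)) (≤-trans 1≤k (≤ᵇ-true⇒≤ k _ (proj₂ x₀)))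
  -- y₀ has the neighbour x₀, so d ≥ deg y₀ ≥ 1
  1≤d : 1 ≤ d
  1≤d = ≤-trans (s≤s z≤n)
          (≤-trans (≤-reflexive (sym (count-remove a (λ x → adj G x (proj₁ y₀)) (proj₁ x₀) (proj₂ y₀))))
                   (degB≤d (proj₁ y₀)))
  module S = Stars G k d degB≤d (proj₁ y₀)
  enough : n * suc (k * (d ∸ 1) + k * (d ∸ 1)) < count a S.heavy
  enough = ≤-<-trans (≤-trans (*-monoʳ-≤ n (star-budget k d 1≤k 1≤d))
                              (≤-reflexive (sym (*-assoc n k (d ^ 2)))))
                     more
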